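{- Let $G$ be a nontrivial finite group of odd order. Then the type of every structure class of $\mathsf{GEN}(G)$ (that is, of $X_I$ for $I\in\mathcal{I}$, and of $X_G$) belongs to $\{(1,0,0),(1,1,0),(1,2,0),(1,2,1)\}$.
   Context: The achievement game $\mathsf{GEN}(G)$ is the impartial game (normal play) with starting position $\emptyset$, positions $\emptyset$, the subsets $P\subseteq G$ with $\langle P\rangle\neq G$, and the subsets $P$ with $\langle P\rangle=G$ such that $\langle P\setminus\{s\}\rangle\neq G$ for some $s\in P$; a non-generating $P$ has options $\{P\cup\{g\}:g\in G\setminus P\}$ and a generating $P$ has none; $\operatorname{nim}(P)=\operatorname{mex}\{\operatorname{nim}(Q):Q\in\operatorname{Opt}(P)\}$ ($\operatorname{mex}$ = least nonnegative integer not in the set). Let $\mathcal{M}$ be the set of maximal subgroups of $G$ and $\mathcal{I}=\{\bigcap\mathcal{N}:\emptyset\neq\mathcal{N}\subseteq\mathcal{M}\}$. For $I\in\mathcal{I}$, $X_I=\{P\subseteq I:\text{there is no }J\in\mathcal{I}\text{ with }J\subsetneq I\text{ and }P\subseteq J\}$; $X_G$ is the set of positions that generate $G$. With $\operatorname{pty}(n)=1$ for odd $n$ and $0$ for even $n$, the type of $X_I$ is $(\operatorname{pty}(|I|),\operatorname{nim}(P),\operatorname{nim}(Q))$ where $P,Q\in X_I$ with $|P|$ even and $|Q|$ odd (well defined since same-parity elements of a structure class have equal nim-numbers), and the type of $X_G$ is $(\operatorname{pty}(|G|),0,0)$. -}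

module Defs where

open import Level using (0ℓ)
open import Data.Nat using (ℕ; zero; suc; _%_)
open import Data.Nat.Properties using () renaming (_≟_ to _≟ℕ_)
open import Data.Bool.Properties using () renaming (_≟_ to _≟𝔹_)
open import Data.Fin using (Fin)
open import Data.Fin.Properties using (all?)
open import Data.Fin.Subset
  using (Subset; _∈_; _∉_; _⊆_; _⊂_; _∪_; ⁅_⁆; ⊤; ⋂; ∣_∣)
open import Data.Fin.Subset.Properties using (_∈?_; _⊆?_; anySubset?)
open import Data.Vec.Properties using (≡-dec)
open import Data.List using (List; []; _∷_; map; filter; allFin; length)
open import Data.List.Relation.Unary.All using (All)
open import Data.List.Membership.DecPropositional _≟ℕ_ using () renaming (_∈?_ to _∈ℕ?_)
open import Data.Product using (Σ; ∃; _×_; _,_)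
open import Data.Sum using (_⊎_)
open import Relation.Nullary using (¬_; Dec; yes; no; ¬?)
open import Relation.Nullary.Decidable using (_×-dec_; _→-dec_)
open import Relation.Binary.PropositionalEquality using (_≡_; _≢_)
open import Algebra.Core using (Op₁; Op₂)
open import Algebra.Structures using (IsGroup)

pty : ℕ → ℕ
pty n = n % 2

-- mex xs = least natural number not occurring in xs.
-- (Searches 0,1,...,length xs - 1; if all occur, length xs cannot occur.)
mexAux : ℕ → ℕ → List ℕ → ℕ
mexAux k zero     xs = k
mexAux k (suc f)  xs with k ∈ℕ? xs
... | yes _ = mexAux (suc k) f xs
... | no  _ = k

mex : List ℕ → ℕ
mex xs = mexAux 0 (length xs) xs

-- A finite group of order n, with carrier Fin n (every finite group is
-- isomorphic to one of this form).

record FinGroup (n : ℕ) : Set where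
  field
    _∙_     : Op₂ (Fin n)
    ε       : Fin n
    _⁻¹     : Op₁ (Fin n)
    isGroup : IsGroup {A = Fin n} _≡_ _∙_ ε _⁻¹

module GEN {n : ℕ} (G : FinGroup n) where
  open FinGroup G

  IsSubgroup : Subset n → Set
  IsSubgroup H = (ε ∈ H)
               × (∀ x y → x ∈ H → y ∈ H → (x ∙ y) ∈ H)
               × (∀ x → x ∈ H → (x ⁻¹) ∈ H)

  isSubgroup? : ∀ H → Dec (IsSubgroup H)
  isSubgroup? H =
    (ε ∈? H)
    ×-dec all? (λ x → all? (λ y → (x ∈? H) →-dec ((y ∈? H) →-dec ((x ∙ y) ∈? H))))
    ×-dec all? (λ x → (x ∈? H) →-dec ((x ⁻¹) ∈? H))

  Generates : Subset n → Set
  Generates P = ∀ H → IsSubgroup H → P ⊆ H → H ≡ ⊤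

  private
    Bad : Subset n → Subset n → Set
    Bad P H = ¬ (IsSubgroup H → P ⊆ H → H ≡ ⊤)

    bad? : ∀ P H → Dec (Bad P H)
    bad? P H = ¬? (isSubgroup? H →-dec ((P ⊆? H) →-dec ≡-dec _≟𝔹_ H ⊤))

  generates? : ∀ P → Dec (Generates P)
  generates? P with anySubset? (bad? P)
  ... | yes (H , b) = no (λ g → b (g H))
  ... | no  nb      = yes (λ H → Relation.Nullary.Decidable.decidable-stable
                                   (isSubgroup? H →-dec ((P ⊆? H) →-dec ≡-dec _≟𝔹_ H ⊤))
                                   (λ k → nb (H , k)))

  IsMaximal : Subset n → Set
  IsMaximal M = IsSubgroup M × M ≢ ⊤
              × (∀ H → IsSubgroup H → M ⊆ H → H ≡ M ⊎ H ≡ ⊤)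

  InI : Subset n → Set
  InI I = Σ (Subset n) λ M → Σ (List (Subset n)) λ Ms →
            All IsMaximal (M ∷ Ms) × ⋂ (M ∷ Ms) ≡ I

  InX : Subset n → Subset n → Set
  InX I P = P ⊆ I × ¬ (Σ (Subset n) λ J → InI J × J ⊂ I × P ⊆ J)

  options : Subset n → List (Subset n)
  options P = map (λ g → P ∪ ⁅ g ⁆) (filter (λ g → ¬? (g ∈? P)) (allFin n))

  -- nim-number with fuel; generating positions have no options (nim 0).
  -- Each move adds one element, so fuel suc n suffices for every P.
  nimF : ℕ → Subset n → ℕ
  nimF zero    P = 0
  nimF (suc f) P with generates? P
  ... | yes _ = 0
  ... | no  _ = mex (map (nimF f) (options P))

  nim : Subset n → ℕ
  nim P = nimF (suc n) P

Type : Set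
Type = ℕ × ℕ × ℕ

AllowedType : Type → Set
AllowedType t = t ≡ (1 , 0 , 0) ⊎ t ≡ (1 , 1 , 0) ⊎ t ≡ (1 , 2 , 0) ⊎ t ≡ (1 , 2 , 1)

-- In a group of odd order no element other than ε is its own inverse, so inversion pairs off
-- the non-identity elements of any subgroup: every subgroup has odd order. Call a position
-- extendable if one more element makes it generate G. Induction over the game shows that a
-- non-generating position P has nim-number 1 (∣P∣ odd) or 2 (∣P∣ even) if it is extendable, and
-- 0 (∣P∣ odd) or one of 1, 2 (∣P∣ even) if it is not. For even ∣P∣ the decisive option adds an
-- element of ⟨P⟩ ∖ P, which exists because ⟨P⟩ has odd order; it keeps the position
-- non-generating and does not change extendability. Finally, a maximal subgroup containing a
-- position of X_I contains I, so the positions of X_I are non-generating and extendable exactly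
-- when I is, and ∣I∣ is odd because I is a subgroup.
module Submission where

open import Level using (0ℓ)
open import Algebra.Bundles using (Group)
import Algebra.Properties.Group as GroupProperties
open import Algebra.Structures using (IsGroup)
open import Data.Bool using (true)
open import Data.Bool.Properties using () renaming (_≟_ to _≟𝔹_)
open import Data.Empty using (⊥-elim)
open import Data.Fin using (Fin; zero; suc) renaming (_≟_ to _≟ᶠ_)
open import Data.Fin.Properties using (any?)
open import Data.Fin.Subset
open import Data.Fin.Subset.Properties
open import Data.Nat using (ℕ; zero; suc; _+_; _<_; _≤_)
open import Data.Nat.Induction using (<-wellFounded)
open import Data.Nat.Properties
  using (<⇒≱; m<n⇒m<1+n; n<1+n; m≤n+m; +-suc; +-identityʳ) renaming (_≟_ to _≟ℕ_)
open import Data.List using (List; []; _∷_; map; allFin; length)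
open import Data.List.Membership.Propositional using () renaming (_∈_ to _∈ˡ_; _∉_ to _∉ˡ_)
open import Data.List.Membership.Propositional.Properties
  using (∈-map⁺; ∈-map⁻; ∈-filter⁺; ∈-filter⁻; ∈-allFin)
open import Data.List.Membership.DecPropositional _≟ℕ_ using () renaming (_∈?_ to _∈ˡ?_)
import Data.List.Relation.Unary.All as All
import Data.List.Relation.Unary.Any as Any
open import Data.Product using (∃-syntax; _×_; _,_; proj₁; proj₂)
open import Data.Product.Properties using (×-≡,≡→≡)
open import Data.Sum using (_⊎_; inj₁; inj₂; [_,_]′)
open import Data.Vec using (_∷_; tabulate)
open import Data.Vec.Base using (here; there)
open import Data.Vec.Properties using (≡-dec; lookup∘tabulate; []=⇒lookup; lookup⇒[]=)
open import Function using (_∘_)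
open import Induction.WellFounded using (Acc; acc)
open import Relation.Nullary using (¬_; Dec; yes; no; does; ¬?; contradiction)
open import Relation.Nullary.Decidable using (_×-dec_; _→-dec_; dec-true; decidable-stable)
open import Relation.Binary.PropositionalEquality
open ≡-Reasoning

open import Defs

pty-suc-even : ∀ k → pty k ≡ 0 → pty (suc k) ≡ 1
pty-suc-even zero          _ = refl
pty-suc-even (suc zero)    ()
pty-suc-even (suc (suc k)) = pty-suc-even k

pty-suc-odd : ∀ k → pty k ≡ 1 → pty (suc k) ≡ 0
pty-suc-odd zero          ()
pty-suc-odd (suc zero)    _ = refl
pty-suc-odd (suc (suc k)) = pty-suc-odd k

∣p∪⁅x⁆∣≡1+∣p∣ : ∀ {n} (p : Subset n) {x} → x ∉ p → ∣ p ∪ ⁅ x ⁆ ∣ ≡ suc ∣ p ∣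
∣p∪⁅x⁆∣≡1+∣p∣ (inside  ∷ p) {zero}  x∉p = ⊥-elim (x∉p here)
∣p∪⁅x⁆∣≡1+∣p∣ (outside ∷ p) {zero}  _   = cong (suc ∘ ∣_∣) (∪-identityʳ p)
∣p∪⁅x⁆∣≡1+∣p∣ (inside  ∷ p) {suc x} x∉p = cong suc (∣p∪⁅x⁆∣≡1+∣p∣ p (x∉p ∘ there))
∣p∪⁅x⁆∣≡1+∣p∣ (outside ∷ p) {suc x} x∉p = ∣p∪⁅x⁆∣≡1+∣p∣ p (x∉p ∘ there)

∣p∣≡1+∣p-x∣ : ∀ {n} (p : Subset n) {x} → x ∈ p → ∣ p ∣ ≡ suc ∣ p - x ∣
∣p∣≡1+∣p-x∣ (inside  ∷ p) here        = cong (suc ∘ ∣_∣) (sym (p─⊥≡p p))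
∣p∣≡1+∣p-x∣ (inside  ∷ p) (there x∈p) = cong suc (∣p∣≡1+∣p-x∣ p x∈p)
∣p∣≡1+∣p-x∣ (outside ∷ p) (there x∈p) = ∣p∣≡1+∣p-x∣ p x∈p

pty∣p∪⁅x⁆∣-even : ∀ {n} {p : Subset n} {x} → x ∉ p → pty ∣ p ∣ ≡ 0 → pty ∣ p ∪ ⁅ x ⁆ ∣ ≡ 1
pty∣p∪⁅x⁆∣-even {p = p} x∉p even = trans (cong pty (∣p∪⁅x⁆∣≡1+∣p∣ p x∉p)) (pty-suc-even ∣ p ∣ even)

pty∣p∪⁅x⁆∣-odd : ∀ {n} {p : Subset n} {x} → x ∉ p → pty ∣ p ∣ ≡ 1 → pty ∣ p ∪ ⁅ x ⁆ ∣ ≡ 0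
pty∣p∪⁅x⁆∣-odd {p = p} x∉p odd = trans (cong pty (∣p∪⁅x⁆∣≡1+∣p∣ p x∉p)) (pty-suc-odd ∣ p ∣ odd)

x∉p-x : ∀ {n} (p : Subset n) x → x ∉ p - x
x∉p-x (_       ∷ p) zero    ()
x∉p-x (inside  ∷ p) (suc x) (there x∈) = x∉p-x p x x∈
x∉p-x (outside ∷ p) (suc x) (there x∈) = x∉p-x p x x∈

x∈p-y⁻ : ∀ {n} {p : Subset n} {x y} → x ∈ p - y → x ∈ p × x ≢ y
x∈p-y⁻ {p = p} {y = y} x∈ = p─q⊆p p ⁅ y ⁆ x∈ , λ { refl → x∉p-x p y x∈ }

x∈p∪⁅x⁆ : ∀ {n} (p : Subset n) x → x ∈ p ∪ ⁅ x ⁆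
x∈p∪⁅x⁆ p x = q⊆p∪q p ⁅ x ⁆ (x∈⁅x⁆ x)

p∪⁅x⁆⊆q : ∀ {n} {p q : Subset n} {x} → p ⊆ q → x ∈ q → p ∪ ⁅ x ⁆ ⊆ q
p∪⁅x⁆⊆q {p = p} {x = x} p⊆q x∈q y∈ with x∈p∪q⁻ p ⁅ x ⁆ y∈
... | inj₁ y∈p   = p⊆q y∈p
... | inj₂ y∈⁅x⁆ rewrite x∈⁅y⁆⇒x≡y x y∈⁅x⁆ = x∈q

⊆∧≢⇒⊂ : ∀ {n} {p q : Subset n} → p ⊆ q → q ≢ p → p ⊂ q
⊆∧≢⇒⊂ {p = p} {q} p⊆q q≢p with any? (λ x → (x ∈? q) ×-dec ¬? (x ∈? p))
... | yes witness = p⊆q , witness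
... | no  none    = contradiction (⊆-antisym q⊆p p⊆q) q≢p
  where
  q⊆p : q ⊆ p
  q⊆p {x} x∈q = decidable-stable (x ∈? p) (λ x∉p → none (x , x∈q , x∉p))

allSubset? : ∀ {n} {P : Subset n → Set} → (∀ p → Dec (P p)) → Dec (∀ p → P p)
allSubset? P? with anySubset? (¬? ∘ P?)
... | yes (p , ¬Pp) = no (λ ∀P → ¬Pp (∀P p))
... | no  ∄¬P       = yes (λ p → decidable-stable (P? p) (λ ¬Pp → ∄¬P (p , ¬Pp)))

select : ∀ {n} {P : Fin n → Set} → (∀ x → Dec (P x)) → Subset n
select P? = tabulate (does ∘ P?)

∈-select⁺ : ∀ {n} {P : Fin n → Set} (P? : ∀ x → Dec (P x)) {x} → P x → x ∈ select P?
∈-select⁺ P? {x} Px = lookup⇒[]= x _ (trans (lookup∘tabulate (does ∘ P?) x) (dec-true (P? x) Px))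

∈-select⁻ : ∀ {n} {P : Fin n → Set} (P? : ∀ x → Dec (P x)) {x} → x ∈ select P? → P x
∈-select⁻ P? {x} x∈ = from-does (P? x) (trans (sym (lookup∘tabulate (does ∘ P?) x)) ([]=⇒lookup x∈))
  where
  from-does : ∀ {A : Set} (A? : Dec A) → does A? ≡ true → A
  from-does (yes a) _  = a
  from-does (no _)  ()

module _ {n : ℕ} (f : Fin n → Fin n) (f-involutive : ∀ x → f (f x) ≡ x) where

  private
    f-injective : ∀ {x y} → f x ≡ f y → x ≡ y
    f-injective {x} {y} fx≡fy = trans (sym (f-involutive x)) (trans (cong f fx≡fy) (f-involutive y))

  fixedPointFree⇒even : ∀ S → (∀ {x} → x ∈ S → f x ∈ S) → (∀ {x} → x ∈ S → f x ≢ x) →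
                        pty ∣ S ∣ ≡ 0
  fixedPointFree⇒even S = go S (<-wellFounded ∣ S ∣)
    where
    go : ∀ S → Acc _<_ ∣ S ∣ → (∀ {x} → x ∈ S → f x ∈ S) → (∀ {x} → x ∈ S → f x ≢ x) →
         pty ∣ S ∣ ≡ 0
    go S (acc smaller) closed free with nonempty? S
    ... | no S-empty = cong pty (trans (cong ∣_∣ (Empty-unique S-empty)) (∣⊥∣≡0 n))
    ... | yes (x , x∈S) =
          trans (cong pty ∣S∣≡2+∣S′∣) (go S′ (smaller ∣S′∣<∣S∣) closed′ free′)
      where
      S′ : Subset n
      S′ = S - x - f x
      fx∈S-x : f x ∈ S - x
      fx∈S-x = x∈p∧x≢y⇒x∈p-y (closed x∈S) (free x∈S)
      ∣S∣≡2+∣S′∣ : ∣ S ∣ ≡ suc (suc ∣ S′ ∣)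
      ∣S∣≡2+∣S′∣ = trans (∣p∣≡1+∣p-x∣ S x∈S) (cong suc (∣p∣≡1+∣p-x∣ (S - x) fx∈S-x))
      ∣S′∣<∣S∣ : ∣ S′ ∣ < ∣ S ∣
      ∣S′∣<∣S∣ = subst (∣ S′ ∣ <_) (sym ∣S∣≡2+∣S′∣) (m<n⇒m<1+n (n<1+n _))
      closed′ : ∀ {y} → y ∈ S′ → f y ∈ S′
      closed′ {y} y∈S′ with x∈p-y⁻ y∈S′
      ... | y∈S-x , y≢fx with x∈p-y⁻ y∈S-x
      ... | y∈S , y≢x =
        x∈p∧x≢y⇒x∈p-y
          (x∈p∧x≢y⇒x∈p-y (closed y∈S) (λ fy≡x → y≢fx (trans (sym (f-involutive y)) (cong f fy≡x))))
          (y≢x ∘ f-injective)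
      free′ : ∀ {y} → y ∈ S′ → f y ≢ y
      free′ = free ∘ proj₁ ∘ x∈p-y⁻ ∘ proj₁ ∘ x∈p-y⁻

mexAux-∉ : ∀ k f xs → k ∉ˡ xs → mexAux k f xs ≡ k
mexAux-∉ k zero    xs _   = refl
mexAux-∉ k (suc f) xs k∉ with k ∈ˡ? xs
... | yes k∈ = contradiction k∈ k∉
... | no  _  = refl

mexAux-∈ : ∀ k f xs → k ∈ˡ xs → mexAux k (suc f) xs ≡ mexAux (suc k) f xs
mexAux-∈ k f xs k∈ with k ∈ˡ? xs
... | yes _  = refl
... | no  k∉ = contradiction k∈ k∉

mex≡0 : ∀ {xs} → 0 ∉ˡ xs → mex xs ≡ 0
mex≡0 {xs} = mexAux-∉ 0 (length xs) xs

mex≡1 : ∀ {xs} → 0 ∈ˡ xs → 1 ∉ˡ xs → mex xs ≡ 1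
mex≡1 {x ∷ xs} 0∈ 1∉ = trans (mexAux-∈ 0 (length xs) (x ∷ xs) 0∈) (mexAux-∉ 1 (length xs) (x ∷ xs) 1∉)

mex≡2 : ∀ {xs} → 0 ∈ˡ xs → 1 ∈ˡ xs → 2 ∉ˡ xs → mex xs ≡ 2
mex≡2 {_ ∷ []}     (Any.here refl) (Any.here ())  _
mex≡2 {_ ∷ []}     _               (Any.there ()) _
mex≡2 {x ∷ y ∷ xs} 0∈ 1∈ 2∉ = begin
  mex (x ∷ y ∷ xs)                         ≡⟨ mexAux-∈ 0 (suc (length xs)) (x ∷ y ∷ xs) 0∈ ⟩
  mexAux 1 (suc (length xs)) (x ∷ y ∷ xs)  ≡⟨ mexAux-∈ 1 (length xs) (x ∷ y ∷ xs) 1∈ ⟩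
  mexAux 2 (length xs) (x ∷ y ∷ xs)        ≡⟨ mexAux-∉ 2 (length xs) (x ∷ y ∷ xs) 2∉ ⟩
  2                                        ∎

mex≡1⊎mex≡2 : ∀ {xs} → 0 ∈ˡ xs → 2 ∉ˡ xs → mex xs ≡ 1 ⊎ mex xs ≡ 2
mex≡1⊎mex≡2 {xs} 0∈ 2∉ with 1 ∈ˡ? xs
... | yes 1∈ = inj₂ (mex≡2 0∈ 1∈ 2∉)
... | no  1∉ = inj₁ (mex≡1 0∈ 1∉)

module _ {n : ℕ} (G : FinGroup n) where

  open FinGroup G
  open IsGroup isGroup using (assoc; identityʳ; inverseʳ)
  open GEN G

  private
    group : Group 0ℓ 0ℓ
    group = record { isGroup = isGroup }

  open GroupProperties group using (⁻¹-involutive; ε⁻¹≈ε; identityʳ-unique)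

  module _ (odd : pty n ≡ 1) where

    selfInverse⇒≡ε : ∀ x → x ⁻¹ ≡ x → x ≡ ε
    selfInverse⇒≡ε x x⁻¹≡x with x ≟ᶠ ε
    ... | yes x≡ε = x≡ε
    ... | no  x≢ε = contradiction (trans (sym ∣G∣-even) (trans (cong pty (∣⊤∣≡n n)) odd)) λ ()
      where
      ∙x-involutive : ∀ y → (y ∙ x) ∙ x ≡ y
      ∙x-involutive y = begin
        (y ∙ x) ∙ x      ≡⟨ assoc y x x ⟩
        y ∙ (x ∙ x)      ≡⟨ cong (λ z → y ∙ (x ∙ z)) (sym x⁻¹≡x) ⟩
        y ∙ (x ∙ (x ⁻¹)) ≡⟨ cong (y ∙_) (inverseʳ x) ⟩
        y ∙ ε            ≡⟨ identityʳ y ⟩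
        y                ∎
      ∣G∣-even : pty ∣ ⊤ {n} ∣ ≡ 0
      ∣G∣-even = fixedPointFree⇒even (_∙ x) ∙x-involutive ⊤ (λ _ → ∈⊤)
                   (λ {y} _ → x≢ε ∘ identityʳ-unique y x)

    subgroup-odd : ∀ {H} → IsSubgroup H → pty ∣ H ∣ ≡ 1
    subgroup-odd {H} (ε∈H , _ , ⁻¹∈H) = begin
      pty ∣ H ∣           ≡⟨ cong pty (∣p∣≡1+∣p-x∣ H ε∈H) ⟩
      pty (suc ∣ H - ε ∣) ≡⟨ pty-suc-even ∣ H - ε ∣ ∣H-ε∣-even ⟩
      1                   ∎
      where
      closed : ∀ {x} → x ∈ H - ε → x ⁻¹ ∈ H - ε
      closed {x} x∈ with x∈p-y⁻ x∈
      ... | x∈H , x≢ε = x∈p∧x≢y⇒x∈p-y (⁻¹∈H x x∈H)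
        (λ x⁻¹≡ε → x≢ε (trans (sym (⁻¹-involutive x)) (trans (cong _⁻¹ x⁻¹≡ε) ε⁻¹≈ε)))
      ∣H-ε∣-even : pty ∣ H - ε ∣ ≡ 0
      ∣H-ε∣-even = fixedPointFree⇒even _⁻¹ ⁻¹-involutive (H - ε) closed
                     (λ {x} x∈ → proj₂ (x∈p-y⁻ x∈) ∘ selfInverse⇒≡ε x)

  Generates-mono : ∀ {S T} → S ⊆ T → Generates S → Generates T
  Generates-mono S⊆T S-gen H H≤G T⊆H = S-gen H H≤G (⊆-trans S⊆T T⊆H)

  maximal⇒¬Generates : ∀ {S M} → IsMaximal M → S ⊆ M → ¬ Generates S
  maximal⇒¬Generates (M≤G , M≢⊤ , _) S⊆M S-gen = M≢⊤ (S-gen _ M≤G S⊆M)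

  proper⇒⊆maximal : ∀ {H} → IsSubgroup H → H ≢ ⊤ → ∃[ M ] IsMaximal M × H ⊆ M
  proper⇒⊆maximal {H} = go H (<-wellFounded ∣ ∁ H ∣)
    where
    _≟ˢ_ : (p q : Subset n) → Dec (p ≡ q)
    _≟ˢ_ = ≡-dec _≟𝔹_
    go : ∀ H → Acc _<_ ∣ ∁ H ∣ → IsSubgroup H → H ≢ ⊤ → ∃[ M ] IsMaximal M × H ⊆ M
    go H (acc smaller) H≤G H≢⊤
      with anySubset? (λ K → isSubgroup? K ×-dec (H ⊆? K) ×-dec ¬? (K ≟ˢ H) ×-dec ¬? (K ≟ˢ ⊤))
    ... | no ∄K = H , (H≤G , H≢⊤ , maximal) , ⊆-refl
      where
      maximal : ∀ K → IsSubgroup K → H ⊆ K → K ≡ H ⊎ K ≡ ⊤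
      maximal K K≤G H⊆K with K ≟ˢ H | K ≟ˢ ⊤
      ... | yes K≡H | _       = inj₁ K≡H
      ... | no  _   | yes K≡⊤ = inj₂ K≡⊤
      ... | no  K≢H | no  K≢⊤ = ⊥-elim (∄K (K , K≤G , H⊆K , K≢H , K≢⊤))
    ... | yes (K , K≤G , H⊆K , K≢H , K≢⊤)
      with go K (smaller (p⊂q⇒∣p∣<∣q∣ (p⊂q⇒∁p⊃∁q (⊆∧≢⇒⊂ H⊆K K≢H)))) K≤G K≢⊤
    ...   | M , M-maximal , K⊆M = M , M-maximal , ⊆-trans H⊆K K⊆M

  ¬Generates⇒⊆maximal : ∀ {S} → ¬ Generates S → ∃[ M ] IsMaximal M × S ⊆ M
  ¬Generates⇒⊆maximal {S} S-nongen
    with anySubset? (λ H → isSubgroup? H ×-dec (S ⊆? H) ×-dec ¬? (≡-dec _≟𝔹_ H ⊤))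
  ... | yes (H , H≤G , S⊆H , H≢⊤) =
        let M , M-maximal , H⊆M = proper⇒⊆maximal H≤G H≢⊤ in M , M-maximal , ⊆-trans S⊆H H⊆M
  ... | no ∄H = ⊥-elim (S-nongen (λ H H≤G S⊆H →
          decidable-stable (≡-dec _≟𝔹_ H ⊤) (λ H≢⊤ → ∄H (H , H≤G , S⊆H , H≢⊤))))

  ∩-isSubgroup : ∀ {H K} → IsSubgroup H → IsSubgroup K → IsSubgroup (H ∩ K)
  ∩-isSubgroup {H} {K} (ε∈H , ∙∈H , ⁻¹∈H) (ε∈K , ∙∈K , ⁻¹∈K) =
    x∈p∩q⁺ (ε∈H , ε∈K) ,
    (λ x y x∈ y∈ → x∈p∩q⁺ (∙∈H x y (∈H x∈) (∈H y∈) , ∙∈K x y (∈K x∈) (∈K y∈))) ,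
    (λ x x∈ → x∈p∩q⁺ (⁻¹∈H x (∈H x∈) , ⁻¹∈K x (∈K x∈)))
    where
    ∈H : ∀ {x} → x ∈ H ∩ K → x ∈ H
    ∈H = proj₁ ∘ x∈p∩q⁻ H K
    ∈K : ∀ {x} → x ∈ H ∩ K → x ∈ K
    ∈K = proj₂ ∘ x∈p∩q⁻ H K

  ⋂-isSubgroup : ∀ {Hs} → All.All IsSubgroup Hs → IsSubgroup (⋂ Hs)
  ⋂-isSubgroup All.[]         = ∈⊤ , (λ _ _ _ _ → ∈⊤) , (λ _ _ → ∈⊤)
  ⋂-isSubgroup (H≤G All.∷ Hs≤G) = ∩-isSubgroup H≤G (⋂-isSubgroup Hs≤G)

  InI⇒IsSubgroup : ∀ {I} → InI I → IsSubgroup I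
  InI⇒IsSubgroup (_ , _ , maximal , ⋂≡I) = subst IsSubgroup ⋂≡I (⋂-isSubgroup (All.map proj₁ maximal))

  _∈⟨_⟩ : Fin n → Subset n → Set
  x ∈⟨ P ⟩ = ∀ H → IsSubgroup H → P ⊆ H → x ∈ H

  _∈⟨_⟩? : ∀ x P → Dec (x ∈⟨ P ⟩)
  x ∈⟨ P ⟩? = allSubset? (λ H → isSubgroup? H →-dec ((P ⊆? H) →-dec (x ∈? H)))

  ⟨_⟩ : Subset n → Subset n
  ⟨ P ⟩ = select (_∈⟨ P ⟩?)

  ⟨⟩-isSubgroup : ∀ P → IsSubgroup ⟨ P ⟩
  ⟨⟩-isSubgroup P =
    ∈-select⁺ (_∈⟨ P ⟩?) (λ H (ε∈H , _) _ → ε∈H) ,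
    (λ x y x∈ y∈ → ∈-select⁺ (_∈⟨ P ⟩?) (λ H H≤G@(_ , ∙∈H , _) P⊆H →
      ∙∈H x y (∈-select⁻ (_∈⟨ P ⟩?) x∈ H H≤G P⊆H) (∈-select⁻ (_∈⟨ P ⟩?) y∈ H H≤G P⊆H))) ,
    (λ x x∈ → ∈-select⁺ (_∈⟨ P ⟩?) (λ H H≤G@(_ , _ , ⁻¹∈H) P⊆H →
      ⁻¹∈H x (∈-select⁻ (_∈⟨ P ⟩?) x∈ H H≤G P⊆H)))

  P⊆⟨P⟩ : ∀ P → P ⊆ ⟨ P ⟩
  P⊆⟨P⟩ P x∈P = ∈-select⁺ (_∈⟨ P ⟩?) (λ _ _ P⊆H → P⊆H x∈P)

  even⇒P⊂⟨P⟩ : pty n ≡ 1 → ∀ {P} → pty ∣ P ∣ ≡ 0 → P ⊂ ⟨ P ⟩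
  even⇒P⊂⟨P⟩ odd {P} even = ⊆∧≢⇒⊂ (P⊆⟨P⟩ P) λ ⟨P⟩≡P →
    contradiction (trans (sym even) (trans (cong (pty ∘ ∣_∣) (sym ⟨P⟩≡P)) (subgroup-odd odd (⟨⟩-isSubgroup P))))
                  λ ()

  ∈⟨⟩-absorbed : ∀ {P T g} → g ∈⟨ P ⟩ → P ⊆ T → Generates (T ∪ ⁅ g ⁆) → Generates T
  ∈⟨⟩-absorbed g∈⟨P⟩ P⊆T T∪g-gen H H≤G T⊆H =
    T∪g-gen H H≤G (p∪⁅x⁆⊆q T⊆H (g∈⟨P⟩ H H≤G (⊆-trans P⊆T T⊆H)))

  Extendable : Subset n → Set
  Extendable P = ∃[ g ] Generates (P ∪ ⁅ g ⁆)

  extendable? : ∀ P → Dec (Extendable P)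
  extendable? P = any? (λ g → generates? (P ∪ ⁅ g ⁆))

  Extendable-mono : ∀ {P Q} → P ⊆ Q → Extendable P → Extendable Q
  Extendable-mono {Q = Q} P⊆Q (g , P∪g-gen) =
    g , Generates-mono (p∪⁅x⁆⊆q (⊆-trans P⊆Q (p⊆p∪q _)) (x∈p∪⁅x⁆ Q g)) P∪g-gen

  ¬Generates-∪∈⟨⟩ : ∀ {P g} → g ∈⟨ P ⟩ → ¬ Generates P → ¬ Generates (P ∪ ⁅ g ⁆)
  ¬Generates-∪∈⟨⟩ g∈⟨P⟩ P-nongen = P-nongen ∘ ∈⟨⟩-absorbed g∈⟨P⟩ ⊆-refl

  ¬Extendable-∪∈⟨⟩ : ∀ {P g} → g ∈⟨ P ⟩ → ¬ Extendable P → ¬ Extendable (P ∪ ⁅ g ⁆)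
  ¬Extendable-∪∈⟨⟩ {P} {g} g∈⟨P⟩ P-blocked (h , P∪g∪h-gen) =
    P-blocked (h , ∈⟨⟩-absorbed g∈⟨P⟩ (p⊆p∪q _) (Generates-mono P∪g∪h⊆P∪h∪g P∪g∪h-gen))
    where
    P∪g∪h⊆P∪h∪g : (P ∪ ⁅ g ⁆) ∪ ⁅ h ⁆ ⊆ (P ∪ ⁅ h ⁆) ∪ ⁅ g ⁆
    P∪g∪h⊆P∪h∪g = p∪⁅x⁆⊆q (p∪⁅x⁆⊆q (⊆-trans (p⊆p∪q _) (p⊆p∪q _)) (x∈p∪⁅x⁆ _ g))
                           (p⊆p∪q _ (x∈p∪⁅x⁆ P h))

  nimF-generating : ∀ {Q} → Generates Q → ∀ f → nimF f Q ≡ 0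
  nimF-generating Q-gen zero = refl
  nimF-generating {Q} Q-gen (suc f) with generates? Q
  ... | yes _        = refl
  ... | no  Q-nongen = contradiction Q-gen Q-nongen

  nimF-suc : ∀ {P} f → ¬ Generates P → nimF (suc f) P ≡ mex (map (nimF f) (options P))
  nimF-suc {P} f P-nongen with generates? P
  ... | yes P-gen = contradiction P-gen P-nongen
  ... | no  _     = refl

  ∈-options⁺ : ∀ {P g} → g ∉ P → P ∪ ⁅ g ⁆ ∈ˡ options P
  ∈-options⁺ {P} {g} g∉P = ∈-map⁺ (λ g → P ∪ ⁅ g ⁆) (∈-filter⁺ (λ g → ¬? (g ∈? P)) (∈-allFin g) g∉P)

  ∈-options⁻ : ∀ {P Q} → Q ∈ˡ options P → ∃[ g ] g ∉ P × Q ≡ P ∪ ⁅ g ⁆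
  ∈-options⁻ {P} Q∈ with ∈-map⁻ (λ g → P ∪ ⁅ g ⁆) Q∈
  ... | g , g∈ , Q≡P∪g = g , proj₂ (∈-filter⁻ (λ g → ¬? (g ∈? P)) {xs = allFin n} g∈) , Q≡P∪g

  record NimClass (P : Subset n) (k : ℕ) : Set where
    field
      extendable-odd    : Extendable P → pty ∣ P ∣ ≡ 1 → k ≡ 1
      extendable-even   : Extendable P → pty ∣ P ∣ ≡ 0 → k ≡ 2
      unextendable-odd  : ¬ Extendable P → pty ∣ P ∣ ≡ 1 → k ≡ 0
      unextendable-even : ¬ Extendable P → pty ∣ P ∣ ≡ 0 → k ≡ 1 ⊎ k ≡ 2

  module NimStep (odd : pty n ≡ 1) (f : ℕ) {P : Subset n} (P-nongen : ¬ Generates P)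
    (option-class : ∀ {g} → g ∉ P → ¬ Generates (P ∪ ⁅ g ⁆) → NimClass (P ∪ ⁅ g ⁆) (nimF f (P ∪ ⁅ g ⁆)))
    where

    values : List ℕ
    values = map (nimF f) (options P)

    value∈ : ∀ {g} → g ∉ P → nimF f (P ∪ ⁅ g ⁆) ∈ˡ values
    value∈ = ∈-map⁺ (nimF f) ∘ ∈-options⁺

    value-cases : ∀ {k} → k ∈ˡ values →
                  Extendable P × k ≡ 0 ⊎ ∃[ g ] g ∉ P × NimClass (P ∪ ⁅ g ⁆) k
    value-cases k∈ with ∈-map⁻ (nimF f) k∈
    ... | Q , Q∈ , refl with ∈-options⁻ Q∈
    ... | g , g∉P , refl with generates? (P ∪ ⁅ g ⁆)
    ...   | yes P∪g-gen    = inj₁ ((g , P∪g-gen) , nimF-generating P∪g-gen f)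
    ...   | no  P∪g-nongen = inj₂ (g , g∉P , option-class g∉P P∪g-nongen)

    extendable⇒0∈values : Extendable P → 0 ∈ˡ values
    extendable⇒0∈values (g , P∪g-gen) = subst (_∈ˡ values) (nimF-generating P∪g-gen f) (value∈ g∉P)
      where
      g∉P : g ∉ P
      g∉P g∈P = P-nongen (Generates-mono (p∪⁅x⁆⊆q ⊆-refl g∈P) P∪g-gen)

    span-option : pty ∣ P ∣ ≡ 0 → ∃[ g ] g ∉ P × g ∈⟨ P ⟩ × NimClass (P ∪ ⁅ g ⁆) (nimF f (P ∪ ⁅ g ⁆))
    span-option even =
      let _ , g , g∈⟨P⟩ , g∉P = even⇒P⊂⟨P⟩ odd even
          g∈⟨P⟩′ = ∈-select⁻ (_∈⟨ P ⟩?) g∈⟨P⟩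
      in g , g∉P , g∈⟨P⟩′ , option-class g∉P (¬Generates-∪∈⟨⟩ g∈⟨P⟩′ P-nongen)

    extendable-odd : Extendable P → pty ∣ P ∣ ≡ 1 → mex values ≡ 1
    extendable-odd ext odd-P = mex≡1 (extendable⇒0∈values ext) 1∉values
      where
      1∉values : 1 ∉ˡ values
      1∉values 1∈ with value-cases 1∈
      ... | inj₁ (_ , ())
      ... | inj₂ (g , g∉P , class) = contradiction
              (NimClass.extendable-even class (Extendable-mono (p⊆p∪q _) ext) (pty∣p∪⁅x⁆∣-odd g∉P odd-P)) λ ()

    extendable-even : Extendable P → pty ∣ P ∣ ≡ 0 → mex values ≡ 2
    extendable-even ext even-P = mex≡2 (extendable⇒0∈values ext) 1∈values 2∉values
      where
      1∈values : 1 ∈ˡ values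
      1∈values =
        let g , g∉P , _ , class = span-option even-P
        in subst (_∈ˡ values)
             (NimClass.extendable-odd class (Extendable-mono (p⊆p∪q _) ext) (pty∣p∪⁅x⁆∣-even g∉P even-P))
             (value∈ g∉P)
      2∉values : 2 ∉ˡ values
      2∉values 2∈ with value-cases 2∈
      ... | inj₁ (_ , ())
      ... | inj₂ (g , g∉P , class) = contradiction
              (NimClass.extendable-odd class (Extendable-mono (p⊆p∪q _) ext) (pty∣p∪⁅x⁆∣-even g∉P even-P)) λ ()

    unextendable-odd : ¬ Extendable P → pty ∣ P ∣ ≡ 1 → mex values ≡ 0
    unextendable-odd P-blocked odd-P = mex≡0 0∉values
      where
      0∉values : 0 ∉ˡ values
      0∉values 0∈ with value-cases 0∈
      ... | inj₁ (ext , _) = P-blocked ext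
      ... | inj₂ (g , g∉P , class) with extendable? (P ∪ ⁅ g ⁆)
      ...   | yes ext = contradiction (NimClass.extendable-even class ext (pty∣p∪⁅x⁆∣-odd g∉P odd-P)) λ ()
      ...   | no  ¬ext = [ (λ ()) , (λ ()) ]′ (NimClass.unextendable-even class ¬ext (pty∣p∪⁅x⁆∣-odd g∉P odd-P))

    unextendable-even : ¬ Extendable P → pty ∣ P ∣ ≡ 0 → mex values ≡ 1 ⊎ mex values ≡ 2
    unextendable-even P-blocked even-P = mex≡1⊎mex≡2 0∈values 2∉values
      where
      0∈values : 0 ∈ˡ values
      0∈values =
        let g , g∉P , g∈⟨P⟩ , class = span-option even-P
        in subst (_∈ˡ values)
             (NimClass.unextendable-odd class (¬Extendable-∪∈⟨⟩ g∈⟨P⟩ P-blocked) (pty∣p∪⁅x⁆∣-even g∉P even-P))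
             (value∈ g∉P)
      2∉values : 2 ∉ˡ values
      2∉values 2∈ with value-cases 2∈
      ... | inj₁ (ext , _) = P-blocked ext
      ... | inj₂ (g , g∉P , class) with extendable? (P ∪ ⁅ g ⁆)
      ...   | yes ext = contradiction (NimClass.extendable-odd class ext (pty∣p∪⁅x⁆∣-even g∉P even-P)) λ ()
      ...   | no  ¬ext = contradiction (NimClass.unextendable-odd class ¬ext (pty∣p∪⁅x⁆∣-even g∉P even-P)) λ ()

  module _ (odd : pty n ≡ 1) where

    -- nimF 0 is a junk value: the fuel has to outlast the at most n ∸ ∣ P ∣ remaining moves.
    nimF-class : ∀ f {P} → n < ∣ P ∣ + f → ¬ Generates P → NimClass P (nimF f P)
    nimF-class zero    {P} fuel _ = contradiction (∣p∣≤n P) (<⇒≱ (subst (n <_) (+-identityʳ ∣ P ∣) fuel))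
    nimF-class (suc f) {P} fuel P-nongen rewrite nimF-suc f P-nongen = record
      { extendable-odd    = extendable-odd
      ; extendable-even   = extendable-even
      ; unextendable-odd  = unextendable-odd
      ; unextendable-even = unextendable-even
      }
      where
      option-fuel : ∀ {g} → g ∉ P → n < ∣ P ∪ ⁅ g ⁆ ∣ + f
      option-fuel g∉P rewrite ∣p∪⁅x⁆∣≡1+∣p∣ P g∉P = subst (n <_) (+-suc ∣ P ∣ f) fuel
      open NimStep odd f P-nongen (nimF-class f ∘ option-fuel)

    nim-class : ∀ {P} → ¬ Generates P → NimClass P (nim P)
    nim-class {P} = nimF-class (suc n) (m≤n+m (suc n) ∣ P ∣)

  InX⇒¬Generates : ∀ {I P} → InI I → InX I P → ¬ Generates P
  InX⇒¬Generates (M , Ms , M-maximal All.∷ _ , ⋂≡I) (P⊆I , _) =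
    maximal⇒¬Generates M-maximal (⊆-trans P⊆I (subst (_⊆ M) ⋂≡I (p∩q⊆p M (⋂ Ms))))

  InX⊆maximal⇒I⊆maximal : ∀ {I P M} → InI I → InX I P → IsMaximal M → P ⊆ M → I ⊆ M
  InX⊆maximal⇒I⊆maximal {I} {P} {M} (M₀ , Ms , maximal , ⋂≡I) (P⊆I , minimal) M-maximal P⊆M {x} x∈I =
    decidable-stable (x ∈? M) λ x∉M →
      minimal (M ∩ I , M∩I∈𝓘 , (p∩q⊆q M I , x , x∈I , x∉M ∘ proj₁ ∘ x∈p∩q⁻ M I) , P⊆M∩I)
    where
    M∩I∈𝓘 : InI (M ∩ I)
    M∩I∈𝓘 = M , M₀ ∷ Ms , M-maximal All.∷ maximal , cong (M ∩_) ⋂≡I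
    P⊆M∩I : P ⊆ M ∩ I
    P⊆M∩I y∈P = x∈p∩q⁺ (P⊆M y∈P , P⊆I y∈P)

  InX⇒Extendable : ∀ {I P} → InI I → InX I P → Extendable I → Extendable P
  InX⇒Extendable {I} {P} I∈𝓘 P∈X (g , I∪g-gen) = g , decidable-stable (generates? (P ∪ ⁅ g ⁆)) P∪g-gen
    where
    P∪g-gen : ¬ ¬ Generates (P ∪ ⁅ g ⁆)
    P∪g-gen P∪g-nongen with ¬Generates⇒⊆maximal P∪g-nongen
    ... | M , M-maximal , P∪g⊆M = maximal⇒¬Generates M-maximal I∪g⊆M I∪g-gen
      where
      I∪g⊆M : I ∪ ⁅ g ⁆ ⊆ M
      I∪g⊆M = p∪⁅x⁆⊆q (InX⊆maximal⇒I⊆maximal I∈𝓘 P∈X M-maximal (⊆-trans (p⊆p∪q _) P∪g⊆M))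
                       (P∪g⊆M (x∈p∪⁅x⁆ P g))

  structureClass-type : pty n ≡ 1 → ∀ {I P Q} → InI I → InX I P → InX I Q →
                        pty ∣ P ∣ ≡ 0 → pty ∣ Q ∣ ≡ 1 → AllowedType (pty ∣ I ∣ , nim P , nim Q)
  structureClass-type odd {I} {P} {Q} I∈𝓘 P∈X Q∈X even-P odd-Q = type (extendable? I)
    where
    P-class : NimClass P (nim P)
    P-class = nim-class odd (InX⇒¬Generates I∈𝓘 P∈X)
    Q-class : NimClass Q (nim Q)
    Q-class = nim-class odd (InX⇒¬Generates I∈𝓘 Q∈X)
    type≡ : ∀ {a b} → nim P ≡ a → nim Q ≡ b → (pty ∣ I ∣ , nim P , nim Q) ≡ (1 , a , b)
    type≡ nimP≡a nimQ≡b = ×-≡,≡→≡ (subgroup-odd odd (InI⇒IsSubgroup I∈𝓘) , ×-≡,≡→≡ (nimP≡a , nimQ≡b))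
    type : Dec (Extendable I) → AllowedType (pty ∣ I ∣ , nim P , nim Q)
    type (yes I-ext) = inj₂ (inj₂ (inj₂ (type≡
      (NimClass.extendable-even P-class (InX⇒Extendable I∈𝓘 P∈X I-ext) even-P)
      (NimClass.extendable-odd  Q-class (InX⇒Extendable I∈𝓘 Q∈X I-ext) odd-Q))))
    type (no I-blocked) =
      [ (λ nimP≡1 → inj₂ (inj₁ (type≡ nimP≡1 nimQ≡0)))
      , (λ nimP≡2 → inj₂ (inj₂ (inj₁ (type≡ nimP≡2 nimQ≡0))))
      ]′ (NimClass.unextendable-even P-class (I-blocked ∘ Extendable-mono (proj₁ P∈X)) even-P)
      where
      nimQ≡0 : nim Q ≡ 0
      nimQ≡0 = NimClass.unextendable-odd Q-class (I-blocked ∘ Extendable-mono (proj₁ Q∈X)) odd-Q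

proposition4p7 : (n : ℕ) (G : FinGroup n) → 2 ≤ n → pty n ≡ 1 →
    (∀ (I : Subset n) → GEN.InI G I →
       ∀ (P Q : Subset n) → GEN.InX G I P → GEN.InX G I Q →
       pty ∣ P ∣ ≡ 0 → pty ∣ Q ∣ ≡ 1 →
       AllowedType (pty ∣ I ∣ , GEN.nim G P , GEN.nim G Q))
    × AllowedType (pty n , 0 , 0)
proposition4p7 n G _ odd =
  (λ _ I∈𝓘 _ _ → structureClass-type G odd I∈𝓘) ,
  subst (λ p → AllowedType (p , 0 , 0)) (sym odd) (inj₁ refl)
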